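{- Let $X$ and $Y$ be linear orderings and let $G\subseteq X\times Y$ satisfy (i) $\exists^{\mathrm{cf}}x\,\exists y\,G(x,y)$, and (ii) $\forall y'\,\exists x'\,\forall x\,\forall y\,\big((x'\le x\wedge y\le y')\to\neg G(x,y)\big)$. Then $G'=\{(x,y)\mid \exists y'(y'\le y\wedge G(x,y'))\}$ is a connection between $X$ and $Y$.
   Context: Variables $x,x'$ range over $X$ and $y,y'$ over $Y$. Write $\exists^{\mathrm{cf}}x\,A(x)$ for $\forall x'\exists x(x'\le x\wedge A(x))$ and $\forall^{\mathrm{cf}}x\,A(x)$ for $\exists x'\forall x(x'\le x\to A(x))$ (similarly for $y$). A connection between $X$ and $Y$ is a relation $H\subseteq X\times Y$ satisfying $\exists^{\mathrm{cf}}x\,\forall^{\mathrm{cf}}y\,H(x,y)$ and $\exists^{\mathrm{cf}}y\,\forall^{\mathrm{cf}}x\,\neg H(x,y)$. -}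

module Defs where

open import Level using (Level; _⊔_)
open import Data.Product using (Σ; _×_; ∃-syntax)
open import Relation.Nullary using (¬_)
open import Relation.Binary.Bundles using (TotalOrder)

module _ {c ℓ₁ ℓ₂ : Level} (X : TotalOrder c ℓ₁ ℓ₂) where
  open TotalOrder X

  ∃cf : ∀ {ℓ} → (Carrier → Set ℓ) → Set (c ⊔ ℓ₂ ⊔ ℓ)
  ∃cf A = ∀ x′ → ∃[ x ] (x′ ≤ x × A x)

  ∀cf : ∀ {ℓ} → (Carrier → Set ℓ) → Set (c ⊔ ℓ₂ ⊔ ℓ)
  ∀cf A = ∃[ x′ ] (∀ x → x′ ≤ x → A x)

IsConnection : ∀ {c ℓ₁ ℓ₂ d m₁ m₂ ℓ}
               (X : TotalOrder c ℓ₁ ℓ₂) (Y : TotalOrder d m₁ m₂) →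
               (TotalOrder.Carrier X → TotalOrder.Carrier Y → Set ℓ) →
               Set (c ⊔ ℓ₂ ⊔ d ⊔ m₂ ⊔ ℓ)
IsConnection X Y H =
  ∃cf X (λ x → ∀cf Y (λ y → H x y)) ×
  ∃cf Y (λ y → ∀cf X (λ x → ¬ H x y))

module Submission where

open import Defs
open import Data.Product using (_×_; ∃-syntax; _,_)
open import Relation.Nullary using (¬_)
open import Relation.Binary.Bundles using (TotalOrder)

-- A witness G x y₀
-- makes G′ x y hold from y₀ onwards, which gives the first half; for the
-- second, the x′ that (ii) assigns to y′ refutes G′ x y′ for all x ≥ x′,
-- since G′ x y′ only uses points of G below y′.

module _ {c ℓ₁ ℓ₂ d m₁ m₂ ℓ}
         (X : TotalOrder c ℓ₁ ℓ₂) (Y : TotalOrder d m₁ m₂)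
         (G : TotalOrder.Carrier X → TotalOrder.Carrier Y → Set ℓ) where

  open TotalOrder X using () renaming (Carrier to A; _≤_ to _≤ˣ_)
  open TotalOrder Y using () renaming (Carrier to B; _≤_ to _≤ʸ_; refl to ≤ʸ-refl)

  upwardClosure : A → B → Set _
  upwardClosure x y = ∃[ y′ ] (y′ ≤ʸ y × G x y′)

  upwardClosure-∀cf : ∀ {x} → ∃[ y ] G x y → ∀cf Y (upwardClosure x)
  upwardClosure-∀cf (y₀ , g) = y₀ , λ y y₀≤y → y₀ , y₀≤y , g

  upwardClosure-∃cf-∀cf : ∃cf X (λ x → ∃[ y ] G x y) →
                          ∃cf X (λ x → ∀cf Y (upwardClosure x))
  upwardClosure-∃cf-∀cf G-cofinal x′ with G-cofinal x′
  ... | x , x′≤x , witness = x , x′≤x , upwardClosure-∀cf witness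

  upwardClosure-∃cf-∀cf-¬ :
    (∀ y′ → ∃[ x′ ] (∀ x y → x′ ≤ˣ x → y ≤ʸ y′ → ¬ G x y)) →
    ∃cf Y (λ y → ∀cf X (λ x → ¬ upwardClosure x y))
  upwardClosure-∃cf-∀cf-¬ G-eventually-absent y′ with G-eventually-absent y′
  ... | x′ , absent =
    y′ , ≤ʸ-refl , x′ , λ { x x′≤x (y , y≤y′ , g) → absent x y x′≤x y≤y′ g }

lemma2p4 : ∀ {c ℓ₁ ℓ₂ d m₁ m₂ ℓ}
    (X : TotalOrder c ℓ₁ ℓ₂) (Y : TotalOrder d m₁ m₂)
    (G : TotalOrder.Carrier X → TotalOrder.Carrier Y → Set ℓ) →
    ∃cf X (λ x → ∃[ y ] G x y) →
    (∀ y′ → ∃[ x′ ] (∀ x y → TotalOrder._≤_ X x′ x → TotalOrder._≤_ Y y y′ → ¬ G x y)) →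
    IsConnection X Y (λ x y → ∃[ y′ ] (TotalOrder._≤_ Y y′ y × G x y′))
lemma2p4 X Y G i ii =
  upwardClosure-∃cf-∀cf X Y G i , upwardClosure-∃cf-∀cf-¬ X Y G ii
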